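{- Let $D=(V,E)$ be a simple digraph with $n$ vertices and $m$ arcs. Then (a1) $A(\lambda, D^{x10}) = (\lambda + 1)^{m-1} (\lambda - m + 1) A(\lambda, D^x)$ for $x \in \{0, 1, +\}$; (a2) $A(\lambda, D^{100}) = \lambda^{m} (\lambda + 1)^{n-1} (\lambda - n +1)$; (a3) $A(\lambda ,D^{1+0}) = \lambda^{m - n} (\lambda + 1)^{n-1} (\lambda - n + 1)A(\lambda , D)$.
   Context: A simple digraph is $D=(V,E)$ with $V$ finite nonempty and $E\subseteq\{(u,v)\in V\times V: u\neq v\}$ (no loops, no multiple arcs); for an arc $e=(u,v)$, $t(e)=u$, $h(e)=v$. $A(D)$ is the 0/1 adjacency matrix and $A(\lambda,D)=\det(\lambda I-A(D))$. The line digraph $D^l$ has vertex set $E$ and arcs $(p,q)$ for $p,q\in E$ with $h(p)=t(q)$. For a simple digraph $G$ on vertex set $U$: $G^0$ is the digraph on $U$ with no arcs, $G^1$ is the digraph on $U$ with all arcs $(u,v)$, $u\ne v$, $G^+=G$, and $G^-$ is the complement (all $(u,v)$ with $u\neq v$ that are not arcs of $G$). For $x,y\in\{0,1,+,-\}$, $D^{xy0}$ is the digraph with vertex set $V\cup E$ (disjoint union) whose arc set is the union of the arcs of $D^x$ (on $V$) and of $(D^l)^y$ (on $E$). -}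

module Defs where

open import Data.Nat as ℕ using (ℕ; zero; suc)
open import Data.Integer as ℤ using (ℤ; +_; _-_; _*_; -_)
open import Data.Fin using (Fin; zero; suc; toℕ; splitAt; punchIn; _≟_)
open import Data.Bool using (Bool; true; false; _∧_; _∨_; not; if_then_else_)
open import Data.Product using (_×_; _,_; proj₁; proj₂)
open import Data.Sum using (inj₁; inj₂)
open import Relation.Nullary using (¬_)
open import Relation.Nullary.Decidable using (⌊_⌋)
open import Relation.Binary.PropositionalEquality using (_≡_)
open import Function.Definitions using (Injective)

-- Vertex set V = Fin n (n ≥ 1 is imposed in the
-- theorem), arc set E enumerated as Fin m; arc e goes from tl e to hd e.

record Digraph (n m : ℕ) : Set where
  field
    arc      : Fin m → Fin n × Fin n
    noLoop   : ∀ e → ¬ (proj₁ (arc e) ≡ proj₂ (arc e))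
    noMulti  : Injective _≡_ _≡_ arc

  tl hd : Fin m → Fin n
  tl e = proj₁ (arc e)
  hd e = proj₂ (arc e)

Rel : ℕ → Set
Rel k = Fin k → Fin k → Bool

any : ∀ {k} → (Fin k → Bool) → Bool
any {zero}  f = false
any {suc k} f = f zero ∨ any (λ i → f (suc i))

adjD : ∀ {n m} → Digraph n m → Rel n
adjD D u v = any (λ e → ⌊ Digraph.tl D e ≟ u ⌋ ∧ ⌊ Digraph.hd D e ≟ v ⌋)

adjLine : ∀ {n m} → Digraph n m → Rel m
adjLine D p q = ⌊ Digraph.hd D p ≟ Digraph.tl D q ⌋

data Op : Set where
  op0 op1 op+ op- : Op

apply : Op → ∀ {k} → Rel k → Rel k
apply op0 G u v = false
apply op1 G u v = not ⌊ u ≟ v ⌋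
apply op+ G u v = G u v
apply op- G u v = not ⌊ u ≟ v ⌋ ∧ not (G u v)

-- D^{xy0} on V ⊎ E, encoded as Fin (n + m): the first n indices are the
-- vertices, the last m indices are the arcs.
total : ∀ {n m} → Op → Op → Digraph n m → Rel (n ℕ.+ m)
total {n} x y D i j with splitAt n i | splitAt n j
... | inj₁ u | inj₁ v = apply x (adjD D) u v
... | inj₂ p | inj₂ q = apply y (adjLine D) p q
... | inj₁ _ | inj₂ _ = false
... | inj₂ _ | inj₁ _ = false

-- Determinants over ℤ (Laplace expansion along the first row) and the
-- characteristic polynomial A(λ,G) = det(λI - A(G)), evaluated at λ ∈ ℤ.

sumFin : ∀ {k} → (Fin k → ℤ) → ℤ
sumFin {zero}  f = + 0
sumFin {suc k} f = f zero ℤ.+ sumFin (λ i → f (suc i))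

sign : ℕ → ℤ
sign zero    = + 1
sign (suc k) = - sign k

det : ∀ {k} → (Fin k → Fin k → ℤ) → ℤ
det {zero}  M = + 1
det {suc k} M =
  sumFin (λ j → sign (toℕ j) * M zero j * det (λ r c → M (suc r) (punchIn j c)))

adjMatrix : ∀ {k} → Rel k → Fin k → Fin k → ℤ
adjMatrix G u v = if G u v then + 1 else + 0

idMatrix : ∀ {k} → Fin k → Fin k → ℤ
idMatrix u v = if ⌊ u ≟ v ⌋ then + 1 else + 0

charPoly : ∀ {k} → Rel k → ℤ → ℤ
charPoly G λ' = det (λ u v → λ' * idMatrix u v - adjMatrix G u v)

module Submission where

-- No arc of D^{xy0} joins V to E, so λI − A(D^{xy0}) is block diagonal and
-- A(λ, D^{xy0}) = A(λ, D^x) · A(λ, (D^l)^y)  (charPoly-total).  The three formulas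
-- then follow from two computations:
--   * the complete digraph K_k has A(λ, K_k) = (λ+1)^(k−1) (λ−k+1)  (charPoly-complete),
--     and the arcless digraph on k vertices has A(λ) = λ^k  (charPoly-empty);
--   * λ^n A(λ, D^l) = λ^m A(λ, D)  (charPoly-line), since A(D^l) = H·T and A(D) = T·H
--     for the head incidence matrix H (m×n) and the tail incidence matrix T (n×m).
-- Both rest on Sylvester's identity x^n det(xI − HT) = x^m det(xI − TH) (for K_k take
-- H, T all-ones vectors), proved with block matrices.  Powers of λ are divided out at λ = 0 using
-- that determinants of polynomial matrices are congruent to their value at 0 modulo λ.

open import Defs
open import Data.Nat using (ℕ; zero; suc; _∸_; _≤_; _<_)
import Data.Nat as ℕ
import Data.Nat.Properties as ℕP
open import Data.Integer using (ℤ; +_; _+_; _-_; _*_; _^_; -_; 0ℤ; 1ℤ; ∣_∣; ≢-nonZero)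
import Data.Integer.Properties as ℤP
open import Data.Integer.Tactic.RingSolver using (solve-∀)
open import Data.Fin using (Fin; zero; suc; toℕ; punchIn; punchOut; _↑ˡ_; _↑ʳ_; _≟_; splitAt)
open import Data.Fin.Properties
  using (suc-injective; ↑ˡ-injective; ↑ʳ-injective; toℕ-↑ˡ; splitAt-↑ˡ; splitAt-↑ʳ;
         punchInᵢ≢i; punchIn-punchOut; any?)
open import Data.Vec.Functional using (_∷_; removeAt)
open import Data.Bool using (Bool; true; false; not; _∧_; if_then_else_)
open import Data.Bool.Properties using (¬-not)
open import Data.Product using (_×_; _,_)
open import Data.Sum using (_⊎_; inj₁; inj₂; [_,_]′)
open import Data.Empty using (⊥-elim)
open import Function using (_∘_)
open import Function.Definitions using (Injective)
open import Relation.Nullary using (¬_; yes; no)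
open import Relation.Nullary.Decidable using (⌊_⌋)
open import Relation.Binary.PropositionalEquality
  using (_≡_; refl; sym; trans; cong; cong₂; module ≡-Reasoning)

open ≡-Reasoning

sumFin-cong : ∀ {k} {f g : Fin k → ℤ} → (∀ i → f i ≡ g i) → sumFin f ≡ sumFin g
sumFin-cong {zero}  f≗g = refl
sumFin-cong {suc k} f≗g = cong₂ _+_ (f≗g zero) (sumFin-cong (f≗g ∘ suc))

sumFin-zero : ∀ {k} {f : Fin k → ℤ} → (∀ i → f i ≡ 0ℤ) → sumFin f ≡ 0ℤ
sumFin-zero {zero}  f≗0 = refl
sumFin-zero {suc k} f≗0 = cong₂ _+_ (f≗0 zero) (sumFin-zero (f≗0 ∘ suc))

sumFin-zeroWeights : ∀ {k} {w x : Fin k → ℤ} → (∀ s → w s ≡ 0ℤ) → sumFin (λ s → w s * x s) ≡ 0ℤ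
sumFin-zeroWeights {x = x} w≗0 = sumFin-zero (λ s → trans (cong (_* x s) (w≗0 s)) (ℤP.*-zeroˡ (x s)))

sumFin-+ : ∀ {k} (f g : Fin k → ℤ) → sumFin (λ i → f i + g i) ≡ sumFin f + sumFin g
sumFin-+ {zero}  f g = refl
sumFin-+ {suc k} f g = begin
    f zero + g zero + sumFin (λ i → f (suc i) + g (suc i))
  ≡⟨ cong (_+_ (f zero + g zero)) (sumFin-+ (f ∘ suc) (g ∘ suc)) ⟩
    f zero + g zero + (sumFin (f ∘ suc) + sumFin (g ∘ suc))
  ≡⟨ interchange (f zero) (g zero) (sumFin (f ∘ suc)) (sumFin (g ∘ suc)) ⟩
    f zero + sumFin (f ∘ suc) + (g zero + sumFin (g ∘ suc))
  ∎
  where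
  interchange : ∀ a b c d → a + b + (c + d) ≡ a + c + (b + d)
  interchange = solve-∀

sumFin-*ˡ : ∀ {k} (a : ℤ) (f : Fin k → ℤ) → sumFin (λ i → a * f i) ≡ a * sumFin f
sumFin-*ˡ {zero}  a f = sym (ℤP.*-zeroʳ a)
sumFin-*ˡ {suc k} a f = trans (cong (_+_ (a * f zero)) (sumFin-*ˡ a (f ∘ suc)))
                              (sym (ℤP.*-distribˡ-+ a (f zero) _))

sumFin-neg : ∀ {k} (f : Fin k → ℤ) → sumFin (λ i → - f i) ≡ - sumFin f
sumFin-neg {zero}  f = refl
sumFin-neg {suc k} f = trans (cong (_+_ (- f zero)) (sumFin-neg (f ∘ suc)))
                             (sym (ℤP.neg-distrib-+ (f zero) _))

sumFin-swap : ∀ {k l} (F : Fin k → Fin l → ℤ) →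
  sumFin (λ i → sumFin (F i)) ≡ sumFin (λ j → sumFin (λ i → F i j))
sumFin-swap {zero} {l} F = sym (sumFin-zero {f = λ j → sumFin {zero} (λ i → F i j)} (λ j → refl))
sumFin-swap {suc k} F = begin
    sumFin (F zero) + sumFin (λ i → sumFin (F (suc i)))
  ≡⟨ cong (_+_ (sumFin (F zero))) (sumFin-swap (F ∘ suc)) ⟩
    sumFin (F zero) + sumFin (λ j → sumFin (λ i → F (suc i) j))
  ≡⟨ sym (sumFin-+ (F zero) (λ j → sumFin (λ i → F (suc i) j))) ⟩
    sumFin (λ j → F zero j + sumFin (λ i → F (suc i) j))
  ∎

sumFin-↑ : ∀ p {q} (f : Fin (p ℕ.+ q) → ℤ) →
  sumFin f ≡ sumFin (λ u → f (u ↑ˡ q)) + sumFin (λ v → f (p ↑ʳ v))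
sumFin-↑ zero    f = sym (ℤP.+-identityˡ _)
sumFin-↑ (suc p) f = trans (cong (_+_ (f zero)) (sumFin-↑ p (f ∘ suc)))
                           (sym (ℤP.+-assoc (f zero) _ _))

sumFin-punchIn : ∀ {k} (r : Fin (suc k)) (f : Fin (suc k) → ℤ) →
  sumFin f ≡ f r + sumFin (f ∘ punchIn r)
sumFin-punchIn          zero    f = refl
sumFin-punchIn {suc k} (suc r) f = begin
    f zero + sumFin (f ∘ suc)
  ≡⟨ cong (_+_ (f zero)) (sumFin-punchIn r (f ∘ suc)) ⟩
    f zero + (f (suc r) + sumFin (f ∘ suc ∘ punchIn r))
  ≡⟨ exchange (f zero) (f (suc r)) _ ⟩
    f (suc r) + (f zero + sumFin (f ∘ suc ∘ punchIn r))
  ∎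
  where
  exchange : ∀ a b c → a + (b + c) ≡ b + (a + c)
  exchange = solve-∀

sumFin-skip : ∀ {k} (r : Fin (suc k)) (f : Fin (suc k) → ℤ) → f r ≡ 0ℤ → sumFin f ≡ sumFin (f ∘ punchIn r)
sumFin-skip r f fᵣ≡0 =
  trans (sumFin-punchIn r f) (trans (cong (_+ sumFin (f ∘ punchIn r)) fᵣ≡0) (ℤP.+-identityˡ _))

idMatrix-diag : ∀ {k} (u : Fin k) → idMatrix u u ≡ 1ℤ
idMatrix-diag u with u ≟ u
... | yes _   = refl
... | no u≢u = ⊥-elim (u≢u refl)

idMatrix-off : ∀ {k} {u v : Fin k} → ¬ u ≡ v → idMatrix u v ≡ 0ℤ
idMatrix-off {u = u} {v} u≢v with u ≟ v
... | yes u≡v = ⊥-elim (u≢v u≡v)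
... | no _    = refl

-- δ only sees whether its arguments are equal, so injective maps preserve it.
idMatrix-inj : ∀ {k l} (f : Fin k → Fin l) → Injective _≡_ _≡_ f →
  ∀ u v → idMatrix (f u) (f v) ≡ idMatrix u v
idMatrix-inj f f-inj u v with u ≟ v
... | yes refl = idMatrix-diag (f u)
... | no u≢v   = idMatrix-off (u≢v ∘ f-inj)

idMatrix-sym : ∀ {k} (u v : Fin k) → idMatrix u v ≡ idMatrix v u
idMatrix-sym u v with u ≟ v
... | yes refl = sym (idMatrix-diag u)
... | no u≢v   = sym (idMatrix-off (u≢v ∘ sym))

sumFin-δ : ∀ {k} (f : Fin k → ℤ) (v : Fin k) → sumFin (λ u → f u * idMatrix u v) ≡ f v
sumFin-δ {suc k} f v = begin
    sumFin (λ u → f u * idMatrix u v)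
  ≡⟨ sumFin-punchIn v (λ u → f u * idMatrix u v) ⟩
    f v * idMatrix v v + sumFin (λ i → f (punchIn v i) * idMatrix (punchIn v i) v)
  ≡⟨ cong₂ _+_ (cong (f v *_) (idMatrix-diag v)) (sumFin-zero offDiagonal) ⟩
    f v * 1ℤ + 0ℤ
  ≡⟨ trans (ℤP.+-identityʳ _) (ℤP.*-identityʳ (f v)) ⟩
    f v
  ∎
  where
  offDiagonal : ∀ i → f (punchIn v i) * idMatrix (punchIn v i) v ≡ 0ℤ
  offDiagonal i = trans (cong (f (punchIn v i) *_) (idMatrix-off (punchInᵢ≢i v i)))
                        (ℤP.*-zeroʳ (f (punchIn v i)))

Mat : ℕ → Set
Mat k = Fin k → Fin k → ℤ

sgn : ∀ {k} → Fin k → ℤ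
sgn i = sign (toℕ i)

minor : ∀ {k} → Fin (suc k) → Mat (suc k) → Mat k
minor j M r c = M (suc r) (punchIn j c)

det-cong : ∀ {k} {M N : Mat k} → (∀ i j → M i j ≡ N i j) → det M ≡ det N
det-cong {zero}  M≗N = refl
det-cong {suc k} M≗N = sumFin-cong λ j →
  cong₂ (λ a b → sgn j * a * b) (M≗N zero j) (det-cong (λ r c → M≗N (suc r) (punchIn j c)))

-- Choosing column j in row 0 and then column c of the remaining ones in row 1 uses the
-- same pair of columns as choosing punchIn j c in row 0 and `partner j c` in row 1.
partner : ∀ {k} → Fin (suc k) → Fin k → Fin k
partner {suc k} zero    c       = zero
partner         (suc j) zero    = j
partner         (suc j) (suc c) = suc (partner j c)

partner-column : ∀ {k} (j : Fin (suc k)) (c : Fin k) → punchIn (punchIn j c) (partner j c) ≡ j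
partner-column {suc k} zero    c       = refl
partner-column         (suc j) zero    = refl
partner-column         (suc j) (suc c) = cong suc (partner-column j c)

partner-rest : ∀ {k} (j : Fin (suc (suc k))) (c : Fin (suc k)) (x : Fin k) →
  punchIn j (punchIn c x) ≡ punchIn (punchIn j c) (punchIn (partner j c) x)
partner-rest zero    c       x       = refl
partner-rest (suc j) zero    x       = refl
partner-rest (suc j) (suc c) zero    = refl
partner-rest {suc k} (suc j) (suc c) (suc x) = cong suc (partner-rest j c x)

partner-sgn : ∀ {k} (j : Fin (suc k)) (c : Fin k) →
  sgn j * sgn c ≡ - (sgn (punchIn j c) * sgn (partner j c))
partner-sgn {suc k} zero    c       = flip (sgn c)
  where flip : ∀ a → 1ℤ * a ≡ - (- a * 1ℤ)
        flip = solve-∀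
partner-sgn         (suc j) zero    = flip (sgn j)
  where flip : ∀ a → - a * 1ℤ ≡ - (1ℤ * a)
        flip = solve-∀
partner-sgn         (suc j) (suc c) =
  trans (unflip (sgn j) (sgn c))
        (trans (partner-sgn j c) (cong -_ (sym (unflip (sgn (punchIn j c)) (sgn (partner j c))))))
  where unflip : ∀ a b → - a * - b ≡ a * b
        unflip = solve-∀

sumFin-partner : ∀ {k} (F : Fin (suc k) → Fin k → ℤ) →
  sumFin (λ j → sumFin (F j)) ≡ sumFin (λ j → sumFin (λ c → F (punchIn j c) (partner j c)))
sumFin-partner {zero}  F = refl
sumFin-partner {suc k} F = begin
    sumFin (F zero) + sumFin (λ j → F (suc j) zero + sumFin (F (suc j) ∘ suc))
  ≡⟨ cong (_+_ (sumFin (F zero)))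
          (sumFin-+ (λ j → F (suc j) zero) (λ j → sumFin (F (suc j) ∘ suc))) ⟩
    sumFin (F zero) + (sumFin (λ j → F (suc j) zero) + sumFin (λ j → sumFin (F (suc j) ∘ suc)))
  ≡⟨ cong (λ z → sumFin (F zero) + (sumFin (λ j → F (suc j) zero) + z))
          (sumFin-partner (λ j c → F (suc j) (suc c))) ⟩
    sumFin (F zero) + (sumFin (λ j → F (suc j) zero) + sumFin (λ j → sumFin (G j)))
  ≡⟨ exchange (sumFin (F zero)) (sumFin (λ j → F (suc j) zero)) _ ⟩
    sumFin (λ j → F (suc j) zero) + (sumFin (F zero) + sumFin (λ j → sumFin (G j)))
  ≡⟨ cong (_+_ (sumFin (λ j → F (suc j) zero))) (sym (sumFin-+ (F zero) (λ j → sumFin (G j)))) ⟩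
    sumFin (λ j → F (suc j) zero) + sumFin (λ j → F zero j + sumFin (G j))
  ∎
  where
  G : Fin (suc k) → Fin k → ℤ
  G j c = F (suc (punchIn j c)) (suc (partner j c))
  exchange : ∀ a b c → a + (b + c) ≡ b + (a + c)
  exchange = solve-∀

swap01 : ∀ {k} → Mat (suc (suc k)) → Mat (suc (suc k))
swap01 M = M (suc zero) ∷ M zero ∷ λ i → M (suc (suc i))

det-expand₂ : ∀ {k} (M : Mat (suc (suc k))) →
  det M ≡ sumFin (λ j → sumFin (λ c → sgn j * M zero j *
            (sgn c * M (suc zero) (punchIn j c) * det (minor c (minor j M)))))
det-expand₂ M = sumFin-cong λ j →
  sym (sumFin-*ˡ (sgn j * M zero j) (λ c → sgn c * M (suc zero) (punchIn j c) * det (minor c (minor j M))))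

-- Swapping the first two rows negates the determinant: in the two-row expansion,
-- reindexing by `partner` exchanges the roles of the rows and flips every sign.
det-swap01 : ∀ {k} (M : Mat (suc (suc k))) → det (swap01 M) ≡ - det M
det-swap01 {k} M = begin
    det (swap01 M)
  ≡⟨ det-expand₂ (swap01 M) ⟩
    sumFin (λ j → sumFin (Swapped j))
  ≡⟨ sumFin-partner Swapped ⟩
    sumFin (λ j → sumFin (λ c → Swapped (punchIn j c) (partner j c)))
  ≡⟨ sumFin-cong (λ j → trans (sumFin-cong (paired j)) (sumFin-neg (Term j))) ⟩
    sumFin (λ j → - sumFin (Term j))
  ≡⟨ sumFin-neg (λ j → sumFin (Term j)) ⟩
    - sumFin (λ j → sumFin (Term j))
  ≡⟨ cong -_ (sym (det-expand₂ M)) ⟩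
    - det M
  ∎
  where
  Rest : Fin (suc (suc k)) → Fin (suc k) → ℤ
  Rest j c = det (minor c (minor j M))
  Term Swapped : Fin (suc (suc k)) → Fin (suc k) → ℤ
  Term    j c = sgn j * M zero j * (sgn c * M (suc zero) (punchIn j c) * Rest j c)
  Swapped j c = sgn j * M (suc zero) j * (sgn c * M zero (punchIn j c) * Rest j c)
  regroup : ∀ s s' a b d → s * b * (s' * a * d) ≡ - (- (s * s') * a * (b * d))
  regroup = solve-∀
  ungroup : ∀ s s' a b d → - (s * s' * a * (b * d)) ≡ - (s * a * (s' * b * d))
  ungroup = solve-∀
  paired : ∀ j c → Swapped (punchIn j c) (partner j c) ≡ - Term j c
  paired j c = begin
      Swapped (punchIn j c) (partner j c)
    ≡⟨ cong₂ (λ a d → sgn (punchIn j c) * M (suc zero) (punchIn j c) * (sgn (partner j c) * M zero a * d))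
         (partner-column j c)
         (det-cong (λ r x → cong (M (suc (suc r))) (sym (partner-rest j c x)))) ⟩
      sgn (punchIn j c) * M (suc zero) (punchIn j c) * (sgn (partner j c) * M zero j * Rest j c)
    ≡⟨ regroup (sgn (punchIn j c)) (sgn (partner j c)) (M zero j) _ (Rest j c) ⟩
      - (- (sgn (punchIn j c) * sgn (partner j c)) * M zero j * (M (suc zero) (punchIn j c) * Rest j c))
    ≡⟨ cong (λ s → - (s * M zero j * (M (suc zero) (punchIn j c) * Rest j c))) (sym (partner-sgn j c)) ⟩
      - (sgn j * sgn c * M zero j * (M (suc zero) (punchIn j c) * Rest j c))
    ≡⟨ ungroup (sgn j) (sgn c) (M zero j) _ (Rest j c) ⟩
      - Term j c
    ∎

-- ℤ has characteristic 0, so alternation follows from antisymmetry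
x≡-x⇒x≡0 : ∀ x → x ≡ - x → x ≡ 0ℤ
x≡-x⇒x≡0 x x≡-x with ℤP.i*j≡0⇒i≡0∨j≡0 (+ 2) (trans (double x) (trans (cong (_+_ x) x≡-x)
                                                                      (ℤP.+-inverseʳ x)))
  where double : ∀ x → + 2 * x ≡ x + x
        double = solve-∀
... | inj₁ ()
... | inj₂ x≡0 = x≡0

det-repeatedRow : ∀ {k} (M : Mat (suc k)) (s : Fin k) → (∀ c → M zero c ≡ M (suc s) c) → det M ≡ 0ℤ
det-repeatedRow {suc k} M zero same = x≡-x⇒x≡0 (det M) (trans (det-cong rows) (det-swap01 M))
  where
  rows : ∀ i c → M i c ≡ swap01 M i c
  rows zero          c = same c
  rows (suc zero)    c = sym (same c)
  rows (suc (suc i)) c = refl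
det-repeatedRow {suc k} M (suc s) same = begin
    det M
  ≡⟨ sym (trans (cong -_ (det-swap01 M)) (ℤP.neg-involutive (det M))) ⟩
    - det (swap01 M)
  ≡⟨ cong -_ (sumFin-zero term) ⟩
    0ℤ
  ∎
  where
  -- every minor of swap01 M along its first row still repeats that row
  term : ∀ j → sgn j * M (suc zero) j * det (minor j (swap01 M)) ≡ 0ℤ
  term j = trans (cong (sgn j * M (suc zero) j *_)
                   (det-repeatedRow (minor j (swap01 M)) s (λ c → same (punchIn j c))))
                 (ℤP.*-zeroʳ (sgn j * M (suc zero) j))

moveToTop : ∀ {k} {Row : Set} → Fin (suc k) → (Fin (suc k) → Row) → Fin (suc k) → Row
moveToTop r M = M r ∷ removeAt M r

-- moving row r to the top passes it over r rows, one sign change each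
det-moveToTop : ∀ {k} (r : Fin (suc k)) (M : Mat (suc k)) → det (moveToTop r M) ≡ sgn r * det M
det-moveToTop zero M = trans (det-cong rows) (sym (ℤP.*-identityˡ (det M)))
  where
  rows : ∀ i c → moveToTop zero M i c ≡ M i c
  rows zero    c = refl
  rows (suc i) c = refl
det-moveToTop {suc k} (suc r) M = begin
    det (moveToTop (suc r) M)
  ≡⟨ det-cong rows ⟩
    det (swap01 N)
  ≡⟨ det-swap01 N ⟩
    - det N
  ≡⟨ cong -_ det-N ⟩
    - (sgn r * det M)
  ≡⟨ ℤP.neg-distribˡ-* (sgn r) (det M) ⟩
    sgn (suc r) * det M
  ∎
  where
  N : Mat (suc (suc k))
  N = M zero ∷ moveToTop r (M ∘ suc)
  rows : ∀ i c → moveToTop (suc r) M i c ≡ swap01 N i c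
  rows zero          c = refl
  rows (suc zero)    c = refl
  rows (suc (suc i)) c = refl
  minorRows : ∀ j i c → minor j N i c ≡ moveToTop r (minor j M) i c
  minorRows j zero    c = refl
  minorRows j (suc i) c = refl
  reorder : ∀ a b s d → a * b * (s * d) ≡ s * (a * b * d)
  reorder = solve-∀
  det-N : det N ≡ sgn r * det M
  det-N = begin
      sumFin (λ j → sgn j * M zero j * det (minor j N))
    ≡⟨ sumFin-cong (λ j → cong (sgn j * M zero j *_)
                           (trans (det-cong (minorRows j)) (det-moveToTop r (minor j M)))) ⟩
      sumFin (λ j → sgn j * M zero j * (sgn r * det (minor j M)))
    ≡⟨ sumFin-cong (λ j → reorder (sgn j) (M zero j) (sgn r) (det (minor j M))) ⟩
      sumFin (λ j → sgn r * (sgn j * M zero j * det (minor j M)))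
    ≡⟨ sumFin-*ˡ (sgn r) (λ j → sgn j * M zero j * det (minor j M)) ⟩
      sgn r * det M
    ∎

sgn-squared : ∀ {k} (r : Fin k) → sgn r * sgn r ≡ 1ℤ
sgn-squared r = go (toℕ r)
  where
  go : ∀ n → sign n * sign n ≡ 1ℤ
  go zero    = refl
  go (suc n) = trans (negSquare (sign n)) (go n)
    where negSquare : ∀ a → - a * - a ≡ a * a
          negSquare = solve-∀

det-viaTop : ∀ {k} (r : Fin (suc k)) (M : Mat (suc k)) → det M ≡ sgn r * det (moveToTop r M)
det-viaTop r M = begin
    det M
  ≡⟨ sym (trans (cong (_* det M) (sgn-squared r)) (ℤP.*-identityˡ (det M))) ⟩
    sgn r * sgn r * det M
  ≡⟨ ℤP.*-assoc (sgn r) (sgn r) (det M) ⟩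
    sgn r * (sgn r * det M)
  ≡⟨ cong (sgn r *_) (sym (det-moveToTop r M)) ⟩
    sgn r * det (moveToTop r M)
  ∎

det-firstRow-linear : ∀ {k l} (a : Fin (suc k) → ℤ) (c : Fin l → ℤ)
  (b : Fin l → Fin (suc k) → ℤ) (R : Fin k → Fin (suc k) → ℤ) →
  det ((λ j → a j + sumFin (λ s → c s * b s j)) ∷ R)
    ≡ det (a ∷ R) + sumFin (λ s → c s * det (b s ∷ R))
det-firstRow-linear {k} a c b R = begin
    sumFin (λ j → sgn j * (a j + sumFin (λ s → c s * b s j)) * d j)
  ≡⟨ sumFin-cong expand ⟩
    sumFin (λ j → sgn j * a j * d j + sumFin (λ s → c s * (sgn j * b s j * d j)))
  ≡⟨ sumFin-+ (λ j → sgn j * a j * d j) (λ j → sumFin (λ s → c s * (sgn j * b s j * d j))) ⟩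
    det (a ∷ R) + sumFin (λ j → sumFin (λ s → c s * (sgn j * b s j * d j)))
  ≡⟨ cong (_+_ (det (a ∷ R))) (sumFin-swap (λ j s → c s * (sgn j * b s j * d j))) ⟩
    det (a ∷ R) + sumFin (λ s → sumFin (λ j → c s * (sgn j * b s j * d j)))
  ≡⟨ cong (_+_ (det (a ∷ R)))
          (sumFin-cong (λ s → sumFin-*ˡ (c s) (λ j → sgn j * b s j * d j))) ⟩
    det (a ∷ R) + sumFin (λ s → c s * det (b s ∷ R))
  ∎
  where
  d : Fin (suc k) → ℤ
  d j = det (λ r col → R r (punchIn j col))
  distribute : ∀ σ x y δ → σ * (x + y) * δ ≡ σ * x * δ + σ * δ * y
  distribute = solve-∀
  reorder : ∀ σ δ γ β → σ * δ * (γ * β) ≡ γ * (σ * β * δ)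
  reorder = solve-∀
  expand : ∀ j → sgn j * (a j + sumFin (λ s → c s * b s j)) * d j
               ≡ sgn j * a j * d j + sumFin (λ s → c s * (sgn j * b s j * d j))
  expand j = trans (distribute (sgn j) (a j) _ (d j))
    (cong (_+_ (sgn j * a j * d j))
      (trans (sym (sumFin-*ˡ (sgn j * d j) (λ s → c s * b s j)))
             (sumFin-cong (λ s → reorder (sgn j) (d j) (c s) (b s j)))))

-- Adding to row r a combination of the other rows (weight c r = 0) preserves the
-- determinant; stated for the matrix with row r moved to the top.
det-addToRow : ∀ {k} (r : Fin (suc k)) (c : Fin (suc k) → ℤ) (M : Mat (suc k)) → c r ≡ 0ℤ →
  det ((λ j → M r j + sumFin (λ s → c s * M s j)) ∷ removeAt M r) ≡ det (moveToTop r M)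
det-addToRow r c M cᵣ≡0 = begin
    det ((λ j → M r j + sumFin (λ s → c s * M s j)) ∷ removeAt M r)
  ≡⟨ det-firstRow-linear (M r) c M (removeAt M r) ⟩
    det (moveToTop r M) + sumFin (λ s → c s * det (M s ∷ removeAt M r))
  ≡⟨ cong (_+_ (det (moveToTop r M))) (sumFin-zero vanishes) ⟩
    det (moveToTop r M) + 0ℤ
  ≡⟨ ℤP.+-identityʳ _ ⟩
    det (moveToTop r M)
  ∎
  where
  -- replacing row r by another row s repeats row s
  vanishes : ∀ s → c s * det (M s ∷ removeAt M r) ≡ 0ℤ
  vanishes s with r ≟ s
  ... | yes refl = trans (cong (_* det (moveToTop r M)) cᵣ≡0) (ℤP.*-zeroˡ (det (moveToTop r M)))
  ... | no r≢s   = trans (cong (c s *_) (det-repeatedRow (M s ∷ removeAt M r) (punchOut r≢s)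
                            (λ col → cong (λ z → M z col) (sym (punchIn-punchOut r≢s)))))
                         (ℤP.*-zeroʳ (c s))

det-addRows : ∀ {k} (marked : Fin k → Bool) (C M P : Mat k) →
  (∀ i s → marked s ≡ true → C i s ≡ 0ℤ) →
  (∀ i s → marked i ≡ false → C i s ≡ 0ℤ) →
  (∀ i c → P i c ≡ M i c + sumFin (λ s → C i s * M s c)) →
  det P ≡ det M
det-addRows {zero} _ _ _ _ _ _ _ = refl
det-addRows {suc k} marked C M P fromUnmarked toMarked P≡M+CM
  with any? (λ i → marked i Data.Bool.≟ true)
-- no row is marked, so C = 0
... | no noneMarked = det-cong λ i c → begin
    P i c
  ≡⟨ P≡M+CM i c ⟩
    M i c + sumFin (λ s → C i s * M s c)
  ≡⟨ cong (_+_ (M i c)) (sumFin-zeroWeights {x = λ s → M s c} (noContribution i)) ⟩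
    M i c + 0ℤ
  ≡⟨ ℤP.+-identityʳ (M i c) ⟩
    M i c
  ∎
  where
  noContribution : ∀ i s → C i s ≡ 0ℤ
  noContribution i s = toMarked i s (¬-not (λ i-marked → noneMarked (i , i-marked)))
-- a marked row r: move it to the top; induction handles the other rows in every minor,
-- and det-addToRow the new top row
... | yes (r , r-marked) = begin
    det P
  ≡⟨ det-viaTop r P ⟩
    sgn r * det (moveToTop r P)
  ≡⟨ cong (sgn r *_) (sumFin-cong (λ j → cong (sgn j * P r j *_) (lowerRows j))) ⟩
    sgn r * det (P r ∷ removeAt M r)
  ≡⟨ cong (sgn r *_) topRow ⟩
    sgn r * det (moveToTop r M)
  ≡⟨ sym (det-viaTop r M) ⟩
    det M
  ∎
  where
  -- the rows other than r still satisfy the hypothesis, since C i r = 0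
  restricted : ∀ a c → P (punchIn r a) c
    ≡ M (punchIn r a) c + sumFin (λ s → C (punchIn r a) (punchIn r s) * M (punchIn r s) c)
  restricted a c = trans (P≡M+CM (punchIn r a) c) (cong (_+_ (M (punchIn r a) c))
    (sumFin-skip r (λ s → C (punchIn r a) s * M s c)
      (trans (cong (_* M r c) (fromUnmarked (punchIn r a) r r-marked)) (ℤP.*-zeroˡ (M r c)))))
  lowerRows : ∀ j → det (minor j (moveToTop r P)) ≡ det (minor j (moveToTop r M))
  lowerRows j = det-addRows (marked ∘ punchIn r) (λ a s → C (punchIn r a) (punchIn r s))
    (minor j (moveToTop r M)) (minor j (moveToTop r P))
    (λ a s → fromUnmarked (punchIn r a) (punchIn r s))
    (λ a s → toMarked (punchIn r a) (punchIn r s))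
    (λ a c → restricted a (punchIn j c))
  expandedRow : Fin (suc k) → ℤ
  expandedRow c = M r c + sumFin (λ s → C r s * M s c)
  firstRow : ∀ i c → (P r ∷ removeAt M r) i c ≡ (expandedRow ∷ removeAt M r) i c
  firstRow zero    c = P≡M+CM r c
  firstRow (suc i) c = refl
  topRow : det (P r ∷ removeAt M r) ≡ det (moveToTop r M)
  topRow = trans (det-cong firstRow) (det-addToRow r (C r) M (fromUnmarked r r r-marked))

det-zeroColumn : ∀ {k} (M : Mat k) (c₀ : Fin k) → (∀ r → M r c₀ ≡ 0ℤ) → det M ≡ 0ℤ
det-zeroColumn {suc k} M c₀ column₀ = sumFin-zero term
  where
  term : ∀ j → sgn j * M zero j * det (minor j M) ≡ 0ℤ
  term j with j ≟ c₀
  ... | yes refl = trans (cong (λ z → sgn j * z * det (minor j M)) (column₀ zero))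
                         (vanish (sgn j) (det (minor j M)))
    where vanish : ∀ a d → a * 0ℤ * d ≡ 0ℤ
          vanish = solve-∀
  ... | no j≢c₀ = trans (cong (sgn j * M zero j *_)
                         (det-zeroColumn (minor j M) (punchOut j≢c₀)
                           (λ r → trans (cong (M (suc r)) (punchIn-punchOut j≢c₀)) (column₀ (suc r)))))
                       (ℤP.*-zeroʳ (sgn j * M zero j))

det-firstColumn : ∀ {k} (M : Mat (suc k)) → (∀ r → M (suc r) zero ≡ 0ℤ) →
  det M ≡ M zero zero * det (λ r c → M (suc r) (suc c))
det-firstColumn {zero}  M _ = trans (ℤP.+-identityʳ (1ℤ * M zero zero * 1ℤ))
                                    (cong (_* 1ℤ) (ℤP.*-identityˡ (M zero zero)))
det-firstColumn {suc k} M column₀ = begin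
    1ℤ * M zero zero * det (minor zero M) + sumFin (λ j → term (suc j))
  ≡⟨ cong (_+_ (1ℤ * M zero zero * det (minor zero M))) (sumFin-zero otherColumns) ⟩
    1ℤ * M zero zero * det (minor zero M) + 0ℤ
  ≡⟨ ℤP.+-identityʳ _ ⟩
    1ℤ * M zero zero * det (minor zero M)
  ≡⟨ cong (_* det (minor zero M)) (ℤP.*-identityˡ (M zero zero)) ⟩
    M zero zero * det (minor zero M)
  ∎
  where
  term : Fin (suc (suc k)) → ℤ
  term j = sgn j * M zero j * det (minor j M)
  -- deleting a column other than the first keeps the zero first column
  otherColumns : ∀ j → term (suc j) ≡ 0ℤ
  otherColumns j =
    trans (cong (sgn (suc j) * M zero (suc j) *_) (det-zeroColumn (minor (suc j) M) zero column₀))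
          (ℤP.*-zeroʳ (sgn (suc j) * M zero (suc j)))

det-scalar : ∀ {k} (a : ℤ) (M : Mat k) → (∀ u v → M u v ≡ a * idMatrix u v) → det M ≡ a ^ k
det-scalar {zero}  a M _      = refl
det-scalar {suc k} a M scalar = begin
    det M
  ≡⟨ det-firstColumn M (λ r → trans (scalar (suc r) zero) (ℤP.*-zeroʳ a)) ⟩
    M zero zero * det (λ r c → M (suc r) (suc c))
  ≡⟨ cong₂ _*_ (trans (scalar zero zero) (ℤP.*-identityʳ a))
               (det-scalar a _ (λ u v → trans (scalar (suc u) (suc v))
                                              (cong (a *_) (idMatrix-inj suc suc-injective u v)))) ⟩
    a * a ^ k
  ∎

↑-cases : ∀ p {q} (Q : Fin (p ℕ.+ q) → Set) → (∀ u → Q (u ↑ˡ q)) → (∀ v → Q (p ↑ʳ v)) → ∀ i → Q i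
↑-cases zero    Q left right i       = right i
↑-cases (suc p) Q left right zero    = left zero
↑-cases (suc p) Q left right (suc i) = ↑-cases p (Q ∘ suc) (left ∘ suc) right i

↑ˡ≢↑ʳ : ∀ p {q} (u : Fin p) (v : Fin q) → ¬ u ↑ˡ q ≡ p ↑ʳ v
↑ˡ≢↑ʳ p {q} u v e
  with () ← trans (sym (splitAt-↑ˡ p u q)) (trans (cong (splitAt p) e) (splitAt-↑ʳ p q v))

sgn-↑ˡ : ∀ {p} q (u : Fin p) → sgn (u ↑ˡ q) ≡ sgn u
sgn-↑ˡ q u = cong sign (toℕ-↑ˡ u q)

punchIn-↑ˡ : ∀ {p} q (u : Fin (suc p)) (v : Fin p) → punchIn (u ↑ˡ q) (v ↑ˡ q) ≡ punchIn u v ↑ˡ q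
punchIn-↑ˡ q zero    v       = refl
punchIn-↑ˡ q (suc u) zero    = refl
punchIn-↑ˡ q (suc u) (suc v) = cong suc (punchIn-↑ˡ q u v)

punchIn-↑ʳ : ∀ {p} q (u : Fin (suc p)) (w : Fin q) → punchIn (u ↑ˡ q) (p ↑ʳ w) ≡ suc p ↑ʳ w
punchIn-↑ʳ         q zero    w = refl
punchIn-↑ʳ {suc p} q (suc u) w = cong suc (punchIn-↑ʳ q u w)

det-blockTriangular : ∀ p {q} (M : Mat (p ℕ.+ q)) → (∀ u v → M (u ↑ˡ q) (p ↑ʳ v) ≡ 0ℤ) →
  det M ≡ det (λ u v → M (u ↑ˡ q) (v ↑ˡ q)) * det (λ u v → M (p ↑ʳ u) (p ↑ʳ v))
det-blockTriangular zero    M _ = sym (ℤP.*-identityˡ (det M))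
det-blockTriangular (suc p) {q} M upperRight = begin
    det M
  ≡⟨ sumFin-↑ (suc p) term ⟩
    sumFin (λ u → term (u ↑ˡ q)) + sumFin (λ v → term (suc p ↑ʳ v))
  ≡⟨ cong₂ _+_ (sumFin-cong leftColumns) (sumFin-zero rightColumns) ⟩
    sumFin (λ u → det D * (sgn u * A zero u * det (minor u A))) + 0ℤ
  ≡⟨ ℤP.+-identityʳ _ ⟩
    sumFin (λ u → det D * (sgn u * A zero u * det (minor u A)))
  ≡⟨ sumFin-*ˡ (det D) (λ u → sgn u * A zero u * det (minor u A)) ⟩
    det D * det A
  ≡⟨ ℤP.*-comm (det D) (det A) ⟩
    det A * det D
  ∎
  where
  A : Mat (suc p)
  A u v = M (u ↑ˡ q) (v ↑ˡ q)
  D : Mat q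
  D u v = M (suc p ↑ʳ u) (suc p ↑ʳ v)
  term : Fin (suc p ℕ.+ q) → ℤ
  term j = sgn j * M zero j * det (minor j M)
  vanish : ∀ a d → a * 0ℤ * d ≡ 0ℤ
  vanish = solve-∀
  rightColumns : ∀ v → term (suc p ↑ʳ v) ≡ 0ℤ
  rightColumns v =
    trans (cong (λ z → sgn (suc p ↑ʳ v) * z * det (minor (suc p ↑ʳ v) M)) (upperRight zero v))
          (vanish (sgn (suc p ↑ʳ v)) (det (minor (suc p ↑ʳ v) M)))
  reorder : ∀ s a d₁ d₂ → s * a * (d₁ * d₂) ≡ d₂ * (s * a * d₁)
  reorder = solve-∀
  -- deleting a column of the first block leaves a smaller block-triangular matrix
  leftColumns : ∀ u → term (u ↑ˡ q) ≡ det D * (sgn u * A zero u * det (minor u A))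
  leftColumns u = begin
      sgn (u ↑ˡ q) * A zero u * det (minor (u ↑ˡ q) M)
    ≡⟨ cong₂ (λ s d → s * A zero u * d) (sgn-↑ˡ q u)
         (det-blockTriangular p (minor (u ↑ˡ q) M)
           (λ a b → trans (cong (M (suc (a ↑ˡ q))) (punchIn-↑ʳ q u b)) (upperRight (suc a) b))) ⟩
      sgn u * A zero u * (det (λ a b → M (suc (a ↑ˡ q)) (punchIn (u ↑ˡ q) (b ↑ˡ q)))
                         * det (λ a b → M (suc (p ↑ʳ a)) (punchIn (u ↑ˡ q) (p ↑ʳ b))))
    ≡⟨ cong₂ (λ d₁ d₂ → sgn u * A zero u * (d₁ * d₂))
         (det-cong (λ a b → cong (M (suc (a ↑ˡ q))) (punchIn-↑ˡ q u b)))
         (det-cong (λ a b → cong (M (suc (p ↑ʳ a))) (punchIn-↑ʳ q u b))) ⟩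
      sgn u * A zero u * (det (minor u A) * det D)
    ≡⟨ reorder (sgn u) (A zero u) (det (minor u A)) (det D) ⟩
      det D * (sgn u * A zero u * det (minor u A))
    ∎

det-identityBlock : ∀ p {q} (M : Mat (p ℕ.+ q)) →
  (∀ u v → M (u ↑ˡ q) (v ↑ˡ q) ≡ idMatrix u v) → (∀ w v → M (p ↑ʳ w) (v ↑ˡ q) ≡ 0ℤ) →
  det M ≡ det (λ a b → M (p ↑ʳ a) (p ↑ʳ b))
det-identityBlock zero    M _ _ = refl
det-identityBlock (suc p) {q} M identity lowerLeft = begin
    det M
  ≡⟨ det-firstColumn M (↑-cases p (λ r → M (suc r) zero ≡ 0ℤ)
                                  (λ u → identity (suc u) zero) (λ w → lowerLeft w zero)) ⟩
    M zero zero * det (λ r c → M (suc r) (suc c))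
  ≡⟨ cong (_* det (λ r c → M (suc r) (suc c))) (identity zero zero) ⟩
    1ℤ * det (λ r c → M (suc r) (suc c))
  ≡⟨ ℤP.*-identityˡ _ ⟩
    det (λ r c → M (suc r) (suc c))
  ≡⟨ det-identityBlock p (λ r c → M (suc r) (suc c))
       (λ u v → trans (identity (suc u) (suc v)) (idMatrix-inj suc suc-injective u v))
       (λ w v → lowerLeft w (suc v)) ⟩
    det (λ a b → M (suc p ↑ʳ a) (suc p ↑ʳ b))
  ∎

det-scaleTopRows : ∀ p {q} (a : ℤ) (M P : Mat (p ℕ.+ q)) →
  (∀ u c → P (u ↑ˡ q) c ≡ a * M (u ↑ˡ q) c) → (∀ w c → P (p ↑ʳ w) c ≡ M (p ↑ʳ w) c) →
  det P ≡ a ^ p * det M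
det-scaleTopRows zero    a M P _ bottom = trans (det-cong bottom) (sym (ℤP.*-identityˡ (det M)))
det-scaleTopRows (suc p) a M P top bottom = begin
    sumFin (λ j → sgn j * P zero j * det (minor j P))
  ≡⟨ sumFin-cong (λ j → cong₂ (λ x y → sgn j * x * y) (top zero j)
       (det-scaleTopRows p a (minor j M) (minor j P) (λ u c → top (suc u) (punchIn j c))
                                                     (λ w c → bottom w (punchIn j c)))) ⟩
    sumFin (λ j → sgn j * (a * M zero j) * (a ^ p * det (minor j M)))
  ≡⟨ sumFin-cong (λ j → reorder (sgn j) a (M zero j) (a ^ p) (det (minor j M))) ⟩
    sumFin (λ j → a * a ^ p * (sgn j * M zero j * det (minor j M)))
  ≡⟨ sumFin-*ˡ (a * a ^ p) (λ j → sgn j * M zero j * det (minor j M)) ⟩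
    a * a ^ p * det M
  ∎
  where
  reorder : ∀ s a m aᵖ d → s * (a * m) * (aᵖ * d) ≡ a * aᵖ * (s * m * d)
  reorder = solve-∀

zeros : ∀ {a b} → Fin a → Fin b → ℤ
zeros _ _ = 0ℤ

block : ∀ {m n} → (Fin m → Fin m → ℤ) → (Fin m → Fin n → ℤ) →
        (Fin n → Fin m → ℤ) → (Fin n → Fin n → ℤ) → Mat (m ℕ.+ n)
block {m} A B C D i j with splitAt m i | splitAt m j
... | inj₁ a | inj₁ b = A a b
... | inj₁ a | inj₂ b = B a b
... | inj₂ a | inj₁ b = C a b
... | inj₂ a | inj₂ b = D a b

module BlockEntries {m n} (A : Fin m → Fin m → ℤ) (B : Fin m → Fin n → ℤ)
                          (C : Fin n → Fin m → ℤ) (D : Fin n → Fin n → ℤ) where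

  topLeft : ∀ a b → block A B C D (a ↑ˡ n) (b ↑ˡ n) ≡ A a b
  topLeft a b rewrite splitAt-↑ˡ m a n | splitAt-↑ˡ m b n = refl

  topRight : ∀ a b → block A B C D (a ↑ˡ n) (m ↑ʳ b) ≡ B a b
  topRight a b rewrite splitAt-↑ˡ m a n | splitAt-↑ʳ m n b = refl

  bottomLeft : ∀ a b → block A B C D (m ↑ʳ a) (b ↑ˡ n) ≡ C a b
  bottomLeft a b rewrite splitAt-↑ʳ m n a | splitAt-↑ˡ m b n = refl

  bottomRight : ∀ a b → block A B C D (m ↑ʳ a) (m ↑ʳ b) ≡ D a b
  bottomRight a b rewrite splitAt-↑ʳ m n a | splitAt-↑ʳ m n b = refl

inBottom : ∀ m {n} → Fin (m ℕ.+ n) → Bool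
inBottom m i = [ (λ _ → false) , (λ _ → true) ]′ (splitAt m i)

det-addTopToBottom : ∀ m n (K : Fin n → Fin m → ℤ) (M P : Mat (m ℕ.+ n)) →
  (∀ u c → P (u ↑ˡ n) c ≡ M (u ↑ˡ n) c) →
  (∀ w c → P (m ↑ʳ w) c ≡ M (m ↑ʳ w) c + sumFin (λ u → K w u * M (u ↑ˡ n) c)) →
  det P ≡ det M
det-addTopToBottom m n K M P top bottom =
  det-addRows (inBottom m) Comb M P fromTop toBottom
    (λ i c → ↑-cases m (λ i → IsCombined i c) (λ u → topRow u c) (λ w → bottomRow w c) i)
  where
  Comb : Mat (m ℕ.+ n)
  Comb = block zeros zeros K zeros
  open BlockEntries zeros zeros K zeros
  fromTop : ∀ i s → inBottom m s ≡ true → Comb i s ≡ 0ℤ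
  fromTop i s with splitAt m i | splitAt m s
  ... | _      | inj₁ _ = λ ()
  ... | inj₁ _ | inj₂ _ = λ _ → refl
  ... | inj₂ _ | inj₂ _ = λ _ → refl
  toBottom : ∀ i s → inBottom m i ≡ false → Comb i s ≡ 0ℤ
  toBottom i s with splitAt m i | splitAt m s
  ... | inj₂ _ | _      = λ ()
  ... | inj₁ _ | inj₁ _ = λ _ → refl
  ... | inj₁ _ | inj₂ _ = λ _ → refl
  IsCombined : Fin (m ℕ.+ n) → Fin (m ℕ.+ n) → Set
  IsCombined i c = P i c ≡ M i c + sumFin (λ s → Comb i s * M s c)
  topRow : ∀ u c → IsCombined (u ↑ˡ n) c
  topRow u c = trans (top u c) (sym (trans (cong (_+_ (M (u ↑ˡ n) c))
                 (sumFin-zeroWeights {x = λ s → M s c}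
                    (↑-cases m (λ s → Comb (u ↑ˡ n) s ≡ 0ℤ) (topLeft u) (topRight u))))
                 (ℤP.+-identityʳ _)))
  bottomRow : ∀ w c → IsCombined (m ↑ʳ w) c
  bottomRow w c = trans (bottom w c) (cong (_+_ (M (m ↑ʳ w) c)) (sym (begin
      sumFin (λ s → Comb (m ↑ʳ w) s * M s c)
    ≡⟨ sumFin-↑ m (λ s → Comb (m ↑ʳ w) s * M s c) ⟩
      sumFin (λ u → Comb (m ↑ʳ w) (u ↑ˡ n) * M (u ↑ˡ n) c)
        + sumFin (λ v → Comb (m ↑ʳ w) (m ↑ʳ v) * M (m ↑ʳ v) c)
    ≡⟨ cong₂ _+_ (sumFin-cong (λ u → cong (_* M (u ↑ˡ n) c) (bottomLeft w u)))
                 (sumFin-zeroWeights {x = λ v → M (m ↑ʳ v) c} (bottomRight w)) ⟩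
      sumFin (λ u → K w u * M (u ↑ˡ n) c) + 0ℤ
    ≡⟨ ℤP.+-identityʳ _ ⟩
      sumFin (λ u → K w u * M (u ↑ˡ n) c)
    ∎)))

det-addBottomToTop : ∀ m n (K : Fin m → Fin n → ℤ) (M P : Mat (m ℕ.+ n)) →
  (∀ u c → P (u ↑ˡ n) c ≡ M (u ↑ˡ n) c + sumFin (λ w → K u w * M (m ↑ʳ w) c)) →
  (∀ w c → P (m ↑ʳ w) c ≡ M (m ↑ʳ w) c) →
  det P ≡ det M
det-addBottomToTop m n K M P top bottom =
  det-addRows (not ∘ inBottom m) Comb M P fromBottom toTop
    (λ i c → ↑-cases m (λ i → IsCombined i c) (λ u → topRow u c) (λ w → bottomRow w c) i)
  where
  Comb : Mat (m ℕ.+ n)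
  Comb = block zeros K zeros zeros
  open BlockEntries zeros K zeros zeros
  fromBottom : ∀ i s → not (inBottom m s) ≡ true → Comb i s ≡ 0ℤ
  fromBottom i s with splitAt m i | splitAt m s
  ... | _      | inj₂ _ = λ ()
  ... | inj₁ _ | inj₁ _ = λ _ → refl
  ... | inj₂ _ | inj₁ _ = λ _ → refl
  toTop : ∀ i s → not (inBottom m i) ≡ false → Comb i s ≡ 0ℤ
  toTop i s with splitAt m i | splitAt m s
  ... | inj₁ _ | _      = λ ()
  ... | inj₂ _ | inj₁ _ = λ _ → refl
  ... | inj₂ _ | inj₂ _ = λ _ → refl
  IsCombined : Fin (m ℕ.+ n) → Fin (m ℕ.+ n) → Set
  IsCombined i c = P i c ≡ M i c + sumFin (λ s → Comb i s * M s c)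
  bottomRow : ∀ w c → IsCombined (m ↑ʳ w) c
  bottomRow w c = trans (bottom w c) (sym (trans (cong (_+_ (M (m ↑ʳ w) c))
                 (sumFin-zeroWeights {x = λ s → M s c}
                    (↑-cases m (λ s → Comb (m ↑ʳ w) s ≡ 0ℤ) (bottomLeft w) (bottomRight w))))
                 (ℤP.+-identityʳ _)))
  topRow : ∀ u c → IsCombined (u ↑ˡ n) c
  topRow u c = trans (top u c) (cong (_+_ (M (u ↑ˡ n) c)) (sym (begin
      sumFin (λ s → Comb (u ↑ˡ n) s * M s c)
    ≡⟨ sumFin-↑ m (λ s → Comb (u ↑ˡ n) s * M s c) ⟩
      sumFin (λ v → Comb (u ↑ˡ n) (v ↑ˡ n) * M (v ↑ˡ n) c)
        + sumFin (λ w → Comb (u ↑ˡ n) (m ↑ʳ w) * M (m ↑ʳ w) c)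
    ≡⟨ cong₂ _+_ (sumFin-zeroWeights {x = λ v → M (v ↑ˡ n) c} (topLeft u))
                 (sumFin-cong (λ w → cong (_* M (m ↑ʳ w) c) (topRight u w))) ⟩
      0ℤ + sumFin (λ w → K u w * M (m ↑ʳ w) c)
    ≡⟨ ℤP.+-identityˡ _ ⟩
      sumFin (λ w → K u w * M (m ↑ʳ w) c)
    ∎)))

_·_ : ∀ {a b c} → (Fin a → Fin b → ℤ) → (Fin b → Fin c → ℤ) → Fin a → Fin c → ℤ
(A · B) i j = sumFin (λ v → A i v * B v j)

-- xI − A, so that charPoly G x = det (charMat x (adjMatrix G)) by definition
charMat : ∀ {k} → ℤ → Mat k → Mat k
charMat x A u v = x * idMatrix u v - A u v

scalarMat : ∀ {k} → ℤ → Mat k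
scalarMat x u v = x * idMatrix u v

·-negˡ : ∀ {a b c} (A : Fin a → Fin b → ℤ) (B : Fin b → Fin c → ℤ) i j →
  sumFin (λ v → - A i v * B v j) ≡ - (A · B) i j
·-negˡ A B i j = trans (sumFin-cong (λ v → sym (ℤP.neg-distribˡ-* (A i v) (B v j))))
                       (sumFin-neg (λ v → A i v * B v j))

sylvesterBlock : ∀ {m n} → ℤ → (Fin m → Fin n → ℤ) → (Fin n → Fin m → ℤ) → Mat (m ℕ.+ n)
sylvesterBlock x H T = block idMatrix H T (scalarMat x)

-- Subtracting T·(top rows) from the bottom rows gives [[I, H], [0, xI − TH]].
det-sylvesterBlock : ∀ m n (H : Fin m → Fin n → ℤ) (T : Fin n → Fin m → ℤ) (x : ℤ) →
  det (sylvesterBlock x H T) ≡ det (charMat x (T · H))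
det-sylvesterBlock m n H T x = begin
    det B
  ≡⟨ sym (det-addTopToBottom m n (λ w u → - T w u) B L L-top L-bottom) ⟩
    det L
  ≡⟨ det-identityBlock m L L.topLeft L.bottomLeft ⟩
    det (λ a b → L (m ↑ʳ a) (m ↑ʳ b))
  ≡⟨ det-cong L.bottomRight ⟩
    det (charMat x (T · H))
  ∎
  where
  B L : Mat (m ℕ.+ n)
  B = sylvesterBlock x H T
  L = block idMatrix H zeros (charMat x (T · H))
  module B = BlockEntries idMatrix H T (scalarMat x)
  module L = BlockEntries idMatrix H zeros (charMat x (T · H))
  L-top : ∀ u c → L (u ↑ˡ n) c ≡ B (u ↑ˡ n) c
  L-top u = ↑-cases m (λ c → L (u ↑ˡ n) c ≡ B (u ↑ˡ n) c)
    (λ b → trans (L.topLeft u b) (sym (B.topLeft u b)))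
    (λ b → trans (L.topRight u b) (sym (B.topRight u b)))
  L-bottom : ∀ w c → L (m ↑ʳ w) c ≡ B (m ↑ʳ w) c + sumFin (λ u → - T w u * B (u ↑ˡ n) c)
  L-bottom w = ↑-cases m (λ c → L (m ↑ʳ w) c ≡ B (m ↑ʳ w) c + sumFin (λ u → - T w u * B (u ↑ˡ n) c))
    (λ b → begin
        L (m ↑ʳ w) (b ↑ˡ n)
      ≡⟨ L.bottomLeft w b ⟩
        0ℤ
      ≡⟨ sym (ℤP.+-inverseʳ (T w b)) ⟩
        T w b + - T w b
      ≡⟨ cong₂ _+_ (sym (B.bottomLeft w b))
           (sym (trans (sumFin-cong (λ u → cong (- T w u *_) (B.topLeft u b)))
                       (sumFin-δ (λ u → - T w u) b))) ⟩
        B (m ↑ʳ w) (b ↑ˡ n) + sumFin (λ u → - T w u * B (u ↑ˡ n) (b ↑ˡ n))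
      ∎)
    (λ b → begin
        L (m ↑ʳ w) (m ↑ʳ b)
      ≡⟨ L.bottomRight w b ⟩
        x * idMatrix w b + - (T · H) w b
      ≡⟨ cong₂ _+_ (sym (B.bottomRight w b))
           (sym (trans (sumFin-cong (λ u → cong (- T w u *_) (B.topRight u b))) (·-negˡ T H w b))) ⟩
        B (m ↑ʳ w) (m ↑ʳ b) + sumFin (λ u → - T w u * B (u ↑ˡ n) (m ↑ʳ b))
      ∎)

-- Multiplying the top rows by x gives Q = [[xI, xH], [T, xI]]; subtracting H·(bottom rows)
-- from its top rows gives [[xI − HT, 0], [T, xI]].
det-scaledSylvesterBlock : ∀ m n (H : Fin m → Fin n → ℤ) (T : Fin n → Fin m → ℤ) (x : ℤ) →
  x ^ m * det (sylvesterBlock x H T) ≡ det (charMat x (H · T)) * x ^ n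
det-scaledSylvesterBlock m n H T x = begin
    x ^ m * det B
  ≡⟨ sym (det-scaleTopRows m x B Q Q-top Q-bottom) ⟩
    det Q
  ≡⟨ sym (det-addBottomToTop m n (λ u w → - H u w) Q R R-top R-bottom) ⟩
    det R
  ≡⟨ det-blockTriangular m R R.topRight ⟩
    det (λ a b → R (a ↑ˡ n) (b ↑ˡ n)) * det (λ a b → R (m ↑ʳ a) (m ↑ʳ b))
  ≡⟨ cong₂ _*_ (det-cong R.topLeft)
               (trans (det-cong R.bottomRight) (det-scalar {n} x (scalarMat x) (λ _ _ → refl))) ⟩
    det (charMat x (H · T)) * x ^ n
  ∎
  where
  B Q R : Mat (m ℕ.+ n)
  B = sylvesterBlock x H T
  Q = block (scalarMat x) (λ u w → x * H u w) T (scalarMat x)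
  R = block (charMat x (H · T)) zeros T (scalarMat x)
  module B = BlockEntries idMatrix H T (scalarMat x)
  module Q = BlockEntries (scalarMat x) (λ u w → x * H u w) T (scalarMat x)
  module R = BlockEntries (charMat x (H · T)) zeros T (scalarMat x)
  Q-top : ∀ u c → Q (u ↑ˡ n) c ≡ x * B (u ↑ˡ n) c
  Q-top u = ↑-cases m (λ c → Q (u ↑ˡ n) c ≡ x * B (u ↑ˡ n) c)
    (λ b → trans (Q.topLeft u b) (sym (cong (x *_) (B.topLeft u b))))
    (λ b → trans (Q.topRight u b) (sym (cong (x *_) (B.topRight u b))))
  Q-bottom : ∀ w c → Q (m ↑ʳ w) c ≡ B (m ↑ʳ w) c
  Q-bottom w = ↑-cases m (λ c → Q (m ↑ʳ w) c ≡ B (m ↑ʳ w) c)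
    (λ b → trans (Q.bottomLeft w b) (sym (B.bottomLeft w b)))
    (λ b → trans (Q.bottomRight w b) (sym (B.bottomRight w b)))
  cancels : ∀ x h → 0ℤ ≡ x * h + - h * x
  cancels = solve-∀
  R-top : ∀ u c → R (u ↑ˡ n) c ≡ Q (u ↑ˡ n) c + sumFin (λ w → - H u w * Q (m ↑ʳ w) c)
  R-top u = ↑-cases m (λ c → R (u ↑ˡ n) c ≡ Q (u ↑ˡ n) c + sumFin (λ w → - H u w * Q (m ↑ʳ w) c))
    (λ b → begin
        R (u ↑ˡ n) (b ↑ˡ n)
      ≡⟨ R.topLeft u b ⟩
        x * idMatrix u b + - (H · T) u b
      ≡⟨ cong₂ _+_ (sym (Q.topLeft u b))
           (sym (trans (sumFin-cong (λ w → cong (- H u w *_) (Q.bottomLeft w b))) (·-negˡ H T u b))) ⟩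
        Q (u ↑ˡ n) (b ↑ˡ n) + sumFin (λ w → - H u w * Q (m ↑ʳ w) (b ↑ˡ n))
      ∎)
    (λ b → begin
        R (u ↑ˡ n) (m ↑ʳ b)
      ≡⟨ R.topRight u b ⟩
        0ℤ
      ≡⟨ cancels x (H u b) ⟩
        x * H u b + - H u b * x
      ≡⟨ cong₂ _+_ (sym (Q.topRight u b)) (sym (begin
          sumFin (λ w → - H u w * Q (m ↑ʳ w) (m ↑ʳ b))
        ≡⟨ sumFin-cong (λ w → trans (cong (- H u w *_) (Q.bottomRight w b))
                                    (sym (ℤP.*-assoc (- H u w) x (idMatrix w b)))) ⟩
          sumFin (λ w → - H u w * x * idMatrix w b)
        ≡⟨ sumFin-δ (λ w → - H u w * x) b ⟩
          - H u b * x
        ∎)) ⟩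
        Q (u ↑ˡ n) (m ↑ʳ b) + sumFin (λ w → - H u w * Q (m ↑ʳ w) (m ↑ʳ b))
      ∎)
  R-bottom : ∀ w c → R (m ↑ʳ w) c ≡ Q (m ↑ʳ w) c
  R-bottom w = ↑-cases m (λ c → R (m ↑ʳ w) c ≡ Q (m ↑ʳ w) c)
    (λ b → trans (R.bottomLeft w b) (sym (Q.bottomLeft w b)))
    (λ b → trans (R.bottomRight w b) (sym (Q.bottomRight w b)))

sylvester : ∀ m n (H : Fin m → Fin n → ℤ) (T : Fin n → Fin m → ℤ) (x : ℤ) →
  x ^ n * det (charMat x (H · T)) ≡ x ^ m * det (charMat x (T · H))
sylvester m n H T x = begin
    x ^ n * det (charMat x (H · T))
  ≡⟨ ℤP.*-comm (x ^ n) (det (charMat x (H · T))) ⟩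
    det (charMat x (H · T)) * x ^ n
  ≡⟨ sym (det-scaledSylvesterBlock m n H T x) ⟩
    x ^ m * det (sylvesterBlock x H T)
  ≡⟨ cong (x ^ m *_) (det-sylvesterBlock m n H T x) ⟩
    x ^ m * det (charMat x (T · H))
  ∎

infix 4 _≈_mod_

record _≈_mod_ (a b d : ℤ) : Set where
  constructor by-multiple
  field
    multiple   : ℤ
    difference : a ≡ b + multiple * d
open _≈_mod_

≈-refl : ∀ {d} a → a ≈ a mod d
≈-refl {d} a = by-multiple 0ℤ (sym (ℤP.+-identityʳ a))

≈-+ : ∀ {d a b c e} → a ≈ b mod d → c ≈ e mod d → a + c ≈ b + e mod d
≈-+ {d} {b = b} {e = e} (by-multiple q a≡) (by-multiple r c≡) =
  by-multiple (q + r) (trans (cong₂ _+_ a≡ c≡) (collect b e q r d))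
  where collect : ∀ b e q r d → b + q * d + (e + r * d) ≡ b + e + (q + r) * d
        collect = solve-∀

≈-* : ∀ {d a b c e} → a ≈ b mod d → c ≈ e mod d → a * c ≈ b * e mod d
≈-* {d} {b = b} {e = e} (by-multiple q a≡) (by-multiple r c≡) =
  by-multiple (b * r + q * e + q * r * d) (trans (cong₂ _*_ a≡ c≡) (collect b e q r d))
  where collect : ∀ b e q r d → (b + q * d) * (e + r * d) ≡ b * e + (b * r + q * e + q * r * d) * d
        collect = solve-∀

≈-neg : ∀ {d a b} → a ≈ b mod d → - a ≈ - b mod d
≈-neg {d} {b = b} (by-multiple q a≡) = by-multiple (- q) (trans (cong -_ a≡) (collect b q d))
  where collect : ∀ b q d → - (b + q * d) ≡ - b + - q * d
        collect = solve-∀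

≈-- : ∀ {d a b c e} → a ≈ b mod d → c ≈ e mod d → a - c ≈ b - e mod d
≈-- a≈b c≈e = ≈-+ a≈b (≈-neg c≈e)

≈-self : ∀ t → t ≈ 0ℤ mod t
≈-self t = by-multiple 1ℤ (sym (trans (ℤP.+-identityˡ (1ℤ * t)) (ℤP.*-identityˡ t)))

≈-sum : ∀ {k d} (f g : Fin k → ℤ) → (∀ i → f i ≈ g i mod d) → sumFin f ≈ sumFin g mod d
≈-sum {zero}  f g _   = ≈-refl 0ℤ
≈-sum {suc k} f g f≈g = ≈-+ (f≈g zero) (≈-sum (f ∘ suc) (g ∘ suc) (f≈g ∘ suc))

≈-det : ∀ {k d} (M N : Mat k) → (∀ i j → M i j ≈ N i j mod d) → det M ≈ det N mod d
≈-det {zero}  M N _   = ≈-refl 1ℤ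
≈-det {suc k} M N M≈N = ≈-sum _ _ (λ j → ≈-* (≈-* (≈-refl (sgn j)) (M≈N zero j))
  (≈-det (minor j M) (minor j N) (λ r c → M≈N (suc r) (punchIn j c))))

-- f(t) ≡ f(0) (mod t) for every integer t, as holds for every integer polynomial f
PolyLike : (ℤ → ℤ) → Set
PolyLike f = ∀ t → f t ≈ f 0ℤ mod t

linear-polyLike : ∀ c → PolyLike (λ t → t - c)
linear-polyLike c t = ≈-- (≈-self t) (≈-refl c)

monomial-polyLike : ∀ d {g} → PolyLike g → PolyLike (λ t → t ^ d * g t)
monomial-polyLike d g-poly t = ≈-* (power d) (g-poly t)
  where
  power : ∀ d → t ^ d ≈ 0ℤ ^ d mod t
  power zero    = ≈-refl 1ℤ
  power (suc d) = ≈-* (≈-self t) (power d)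

charMat-polyLike : ∀ {k} (A : Mat k) → PolyLike (λ t → det (charMat t A))
charMat-polyLike A t = ≈-det (charMat t A) (charMat 0ℤ A)
  (λ u v → ≈-- (≈-* (≈-self t) (≈-refl (idMatrix u v))) (≈-refl (A u v)))

^≢0 : ∀ {t} a → ¬ t ≡ 0ℤ → ¬ t ^ a ≡ 0ℤ
^≢0 zero    t≢0 ()
^≢0 {t} (suc a) t≢0 tᵃ⁺¹≡0 with ℤP.i*j≡0⇒i≡0∨j≡0 t tᵃ⁺¹≡0
... | inj₁ t≡0  = t≢0 t≡0
... | inj₂ tᵃ≡0 = ^≢0 a t≢0 tᵃ≡0

n≡k*[1+n]⇒n≡0 : ∀ n k → n ≡ k ℕ.* suc n → n ≡ 0
n≡k*[1+n]⇒n≡0 n zero    n≡0 = n≡0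
n≡k*[1+n]⇒n≡0 n (suc k) n≡[1+k]*[1+n] =
  ⊥-elim (ℕP.<-irrefl refl (ℕP.≤-trans (ℕP.m≤m+n (suc n) (k ℕ.* suc n))
                                       (ℕP.≤-reflexive (sym n≡[1+k]*[1+n]))))

-- Polynomial-like f, g with t^a f(t) = t^a g(t) for all t agree everywhere: at t ≠ 0
-- cancel t^a; f(0) − g(0) is then a multiple of every L ≠ 0, so of 1 + |f(0) − g(0)|.
cancel-power : ∀ a {f g} → PolyLike f → PolyLike g → (∀ t → t ^ a * f t ≡ t ^ a * g t) → ∀ t → f t ≡ g t
cancel-power a {f} {g} f-poly g-poly tᵃf≡tᵃg = agree
  where
  atNonzero : ∀ t → ¬ t ≡ 0ℤ → f t ≡ g t
  atNonzero t t≢0 = ℤP.*-cancelˡ-≡ (t ^ a) (f t) (g t) {{≢-nonZero (^≢0 a t≢0)}} (tᵃf≡tᵃg t)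
  G L : ℤ
  G = f 0ℤ - g 0ℤ
  L = + suc ∣ G ∣
  rearrange : ∀ x y p s l → x + p * l ≡ y + s * l → x - y ≡ (s - p) * l
  rearrange x y p s l e = trans (expand x y p l) (trans (cong (λ z → z - p * l - y) e) (collect y p s l))
    where
    expand : ∀ x y p l → x - y ≡ x + p * l - p * l - y
    expand = solve-∀
    collect : ∀ y p s l → y + s * l - p * l - y ≡ (s - p) * l
    collect = solve-∀
  q r : ℤ
  q = multiple (f-poly L)
  r = multiple (g-poly L)
  G≡ : G ≡ (r - q) * L
  G≡ = rearrange (f 0ℤ) (g 0ℤ) q r L
         (trans (sym (difference (f-poly L))) (trans (atNonzero L (λ ())) (difference (g-poly L))))
  atZero : f 0ℤ ≡ g 0ℤ
  atZero = ℤP.i-j≡0⇒i≡j (f 0ℤ) (g 0ℤ)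
    (ℤP.∣i∣≡0⇒i≡0 (n≡k*[1+n]⇒n≡0 ∣ G ∣ ∣ r - q ∣ (trans (cong ∣_∣ G≡) (ℤP.abs-* (r - q) L))))
  agree : ∀ t → f t ≡ g t
  agree t with t ℤP.≟ 0ℤ
  ... | yes refl = atZero
  ... | no t≢0   = atNonzero t t≢0

divide-powers : ∀ a d {f g} → PolyLike f → PolyLike g →
  (∀ t → t ^ a * f t ≡ t ^ (a ℕ.+ d) * g t) → ∀ t → f t ≡ t ^ d * g t
divide-powers a d {f} {g} f-poly g-poly eq = cancel-power a f-poly (monomial-polyLike d g-poly) λ t →
  trans (eq t) (trans (cong (_* g t) (ℤP.^-distribˡ-+-* t a d)) (ℤP.*-assoc (t ^ a) (t ^ d) (g t)))

indicator : Bool → ℤ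
indicator b = if b then + 1 else + 0

ones : ∀ {a b} → Fin a → Fin b → ℤ
ones _ _ = 1ℤ

sumFin-ones : ∀ k → sumFin {k} (λ _ → 1ℤ * 1ℤ) ≡ + k
sumFin-ones zero    = refl
sumFin-ones (suc k) = trans (cong (_+_ 1ℤ) (sumFin-ones k)) (sym (ℤP.pos-+ 1 k))

-- det(tI − J) = t^k (t − (k+1)) for the all-ones (k+1)×(k+1) matrix J = 1·1ᵀ, by
-- Sylvester's identity against the 1×1 matrix 1ᵀ·1 = (k+1), whose determinant
-- unfolds to 1 * (t * 1 − (k+1)) * 1 + 0.
det-t-J : ∀ k t → det (charMat t (ones {suc k} {suc k})) ≡ t ^ k * (t - + suc k)
det-t-J k = cancel-power 1 (charMat-polyLike (ones {suc k} {suc k}))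
                            (monomial-polyLike k (linear-polyLike (+ suc k))) λ t → begin
    t ^ 1 * det (charMat t (ones {suc k} {suc k}))
  ≡⟨ sylvester (suc k) 1 ones ones t ⟩
    t ^ suc k * (1ℤ * (t * 1ℤ - sumFin {suc k} (λ _ → 1ℤ * 1ℤ)) * 1ℤ + 0ℤ)
  ≡⟨ cong (λ s → t ^ suc k * (1ℤ * (t * 1ℤ - s) * 1ℤ + 0ℤ)) (sumFin-ones (suc k)) ⟩
    t ^ suc k * (1ℤ * (t * 1ℤ - + suc k) * 1ℤ + 0ℤ)
  ≡⟨ regroup t (t ^ k) (+ suc k) ⟩
    t ^ 1 * (t ^ k * (t - + suc k))
  ∎
  where
  regroup : ∀ t tᵏ s → t * tᵏ * (1ℤ * (t * 1ℤ - s) * 1ℤ + 0ℤ) ≡ t * 1ℤ * (tᵏ * (t - s))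
  regroup = solve-∀

charPoly-complete : ∀ {k} (G : Rel (suc k)) t → charPoly (apply op1 G) t ≡ (t + 1ℤ) ^ k * (t - + suc k + 1ℤ)
charPoly-complete {k} G t = begin
    charPoly (apply op1 G) t
  ≡⟨ det-cong {M = charMat t (adjMatrix (apply op1 G))} {N = charMat (t + 1ℤ) ones}
              (λ u v → shift ⌊ u ≟ v ⌋) ⟩
    det (charMat (t + 1ℤ) (ones {suc k} {suc k}))
  ≡⟨ det-t-J k (t + 1ℤ) ⟩
    (t + 1ℤ) ^ k * (t + 1ℤ - + suc k)
  ≡⟨ cong ((t + 1ℤ) ^ k *_) (reorder t (+ suc k)) ⟩
    (t + 1ℤ) ^ k * (t - + suc k + 1ℤ)
  ∎
  where
  onDiagonal : ∀ t → t * 1ℤ - 0ℤ ≡ (t + 1ℤ) * 1ℤ - 1ℤ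
  onDiagonal = solve-∀
  offDiagonal : ∀ t → t * 0ℤ - 1ℤ ≡ (t + 1ℤ) * 0ℤ - 1ℤ
  offDiagonal = solve-∀
  -- entrywise, λI − (J − I) = (λ+1)I − J
  shift : ∀ b → t * indicator b - indicator (not b) ≡ (t + 1ℤ) * indicator b - 1ℤ
  shift true  = onDiagonal t
  shift false = offDiagonal t
  reorder : ∀ t s → t + 1ℤ - s ≡ t - s + 1ℤ
  reorder = solve-∀

charPoly-empty : ∀ {k} (G : Rel k) t → charPoly (apply op0 G) t ≡ t ^ k
charPoly-empty G t =
  det-scalar t (charMat t (adjMatrix (apply op0 G))) (λ u v → ℤP.+-identityʳ (t * idMatrix u v))

headIncidence : ∀ {n m} → Digraph n m → Fin m → Fin n → ℤ
headIncidence D e v = idMatrix (Digraph.hd D e) v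

tailIncidence : ∀ {n m} → Digraph n m → Fin n → Fin m → ℤ
tailIncidence D v e = idMatrix (Digraph.tl D e) v

adjLine-factors : ∀ {n m} (D : Digraph n m) p q →
  adjMatrix (adjLine D) p q ≡ (headIncidence D · tailIncidence D) p q
adjLine-factors D p q = sym (trans (sumFin-cong (λ v → cong (idMatrix (hd p) v *_) (idMatrix-sym (tl q) v)))
                                   (sumFin-δ (idMatrix (hd p)) (tl q)))
  where open Digraph D

≟-sound : ∀ {k} {a b : Fin k} → ⌊ a ≟ b ⌋ ≡ true → a ≡ b
≟-sound {a = a} {b} a≟b with a ≟ b
... | yes a≡b = a≡b

∧-true : ∀ {a b} → a ∧ b ≡ true → a ≡ true × b ≡ true
∧-true {true} {true} _ = refl , refl

indicator-∧ : ∀ a b → indicator a * indicator b ≡ indicator (a ∧ b)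
indicator-∧ true  true  = refl
indicator-∧ true  false = refl
indicator-∧ false b     = refl

sumFin-indicator : ∀ {k} (p : Fin k → Bool) → (∀ i j → p i ≡ true → p j ≡ true → i ≡ j) →
  sumFin (λ i → indicator (p i)) ≡ indicator (any p)
sumFin-indicator {zero}  p unique = refl
sumFin-indicator {suc k} p unique with p zero in p₀
... | true  = cong (_+_ 1ℤ) (sumFin-zero rest)
  where
  rest : ∀ i → indicator (p (suc i)) ≡ 0ℤ
  rest i with p (suc i) in pᵢ
  ... | true with () ← unique zero (suc i) p₀ pᵢ
  ... | false = refl
... | false = trans (ℤP.+-identityˡ _)
                    (sumFin-indicator (p ∘ suc) (λ i j pᵢ pⱼ → suc-injective (unique (suc i) (suc j) pᵢ pⱼ)))

-- u → v in D iff some arc joins u to v; as D has no multiple arcs, at most one does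
adjD-factors : ∀ {n m} (D : Digraph n m) u v →
  adjMatrix (adjD D) u v ≡ (tailIncidence D · headIncidence D) u v
adjD-factors {m = m} D u v =
  sym (trans (sumFin-cong (λ e → indicator-∧ ⌊ tl e ≟ u ⌋ ⌊ hd e ≟ v ⌋))
             (sumFin-indicator joins joins-unique))
  where
  open Digraph D
  joins : Fin m → Bool
  joins e = ⌊ tl e ≟ u ⌋ ∧ ⌊ hd e ≟ v ⌋
  endpoints : ∀ e → joins e ≡ true → arc e ≡ (u , v)
  endpoints e joins-e with ∧-true {⌊ tl e ≟ u ⌋} joins-e
  ... | tl≡u , hd≡v = cong₂ _,_ (≟-sound tl≡u) (≟-sound hd≡v)
  joins-unique : ∀ e f → joins e ≡ true → joins f ≡ true → e ≡ f
  joins-unique e f joins-e joins-f = noMulti (trans (endpoints e joins-e) (sym (endpoints f joins-f)))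

charPoly-line : ∀ {n m} (D : Digraph n m) t → t ^ n * charPoly (adjLine D) t ≡ t ^ m * charPoly (adjD D) t
charPoly-line {n} {m} D t = begin
    t ^ n * charPoly (adjLine D) t
  ≡⟨ cong (t ^ n *_) (det-cong (λ p q → cong (_-_ (t * idMatrix p q)) (adjLine-factors D p q))) ⟩
    t ^ n * det (charMat t (H · T))
  ≡⟨ sylvester m n H T t ⟩
    t ^ m * det (charMat t (T · H))
  ≡⟨ cong (t ^ m *_) (sym (det-cong (λ u v → cong (_-_ (t * idMatrix u v)) (adjD-factors D u v)))) ⟩
    t ^ m * charPoly (adjD D) t
  ∎
  where
  H : Fin m → Fin n → ℤ
  H = headIncidence D
  T : Fin n → Fin m → ℤ
  T = tailIncidence D

total-vertices : ∀ {n m} (x y : Op) (D : Digraph n m) a b →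
  total x y D (a ↑ˡ m) (b ↑ˡ m) ≡ apply x (adjD D) a b
total-vertices {n} {m} x y D a b rewrite splitAt-↑ˡ n a m | splitAt-↑ˡ n b m = refl

total-vertexToArc : ∀ {n m} (x y : Op) (D : Digraph n m) a e → total x y D (a ↑ˡ m) (n ↑ʳ e) ≡ false
total-vertexToArc {n} {m} x y D a e rewrite splitAt-↑ˡ n a m | splitAt-↑ʳ n m e = refl

total-arcs : ∀ {n m} (x y : Op) (D : Digraph n m) e f →
  total x y D (n ↑ʳ e) (n ↑ʳ f) ≡ apply y (adjLine D) e f
total-arcs {n} {m} x y D e f rewrite splitAt-↑ʳ n m e | splitAt-↑ʳ n m f = refl

charPoly-total : ∀ {n m} (x y : Op) (D : Digraph n m) t →
  charPoly (total x y D) t ≡ charPoly (apply x (adjD D)) t * charPoly (apply y (adjLine D)) t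
charPoly-total {n} {m} x y D t =
  trans (det-blockTriangular n (charMat t (adjMatrix (total x y D))) vertexToArc)
        (cong₂ _*_ (det-cong (λ a b → cong₂ entry (idMatrix-inj (_↑ˡ m) (λ {i} {j} → ↑ˡ-injective m i j) a b)
                                                   (total-vertices x y D a b)))
                   (det-cong (λ e f → cong₂ entry (idMatrix-inj (n ↑ʳ_) (λ {i} {j} → ↑ʳ-injective n i j) e f)
                                                   (total-arcs x y D e f))))
  where
  entry : ℤ → Bool → ℤ
  entry δ b = t * δ - indicator b
  vanish : ∀ t → t * 0ℤ - 0ℤ ≡ 0ℤ
  vanish = solve-∀
  vertexToArc : ∀ a e → charMat t (adjMatrix (total x y D)) (a ↑ˡ m) (n ↑ʳ e) ≡ 0ℤ
  vertexToArc a e =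
    trans (cong₂ entry (idMatrix-off (↑ˡ≢↑ʳ n a e)) (total-vertexToArc x y D a e)) (vanish t)

charPoly-x10 : ∀ {n m} (x : Op) (D : Digraph n m) t k → m ≡ suc k →
  charPoly (total x op1 D) t ≡ (t + + 1) ^ k * (t - + m + + 1) * charPoly (apply x (adjD D)) t
charPoly-x10 x D t k refl = begin
    charPoly (total x op1 D) t
  ≡⟨ charPoly-total x op1 D t ⟩
    charPoly (apply x (adjD D)) t * charPoly (apply op1 (adjLine D)) t
  ≡⟨ cong (charPoly (apply x (adjD D)) t *_) (charPoly-complete (adjLine D) t) ⟩
    charPoly (apply x (adjD D)) t * ((t + + 1) ^ k * (t - + suc k + + 1))
  ≡⟨ ℤP.*-comm (charPoly (apply x (adjD D)) t) _ ⟩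
    (t + + 1) ^ k * (t - + suc k + + 1) * charPoly (apply x (adjD D)) t
  ∎

charPoly-x10-noArcs : ∀ {n m} (x : Op) (D : Digraph n m) t → m ≡ 0 →
  charPoly (total x op1 D) t ≡ charPoly (apply x (adjD D)) t
charPoly-x10-noArcs x D t refl = trans (charPoly-total x op1 D t) (ℤP.*-identityʳ _)

charPoly-100 : ∀ {n m} (D : Digraph (suc n) m) t →
  charPoly (total op1 op0 D) t ≡ t ^ m * (t + + 1) ^ n * (t - + suc n + + 1)
charPoly-100 {n} {m} D t = begin
    charPoly (total op1 op0 D) t
  ≡⟨ charPoly-total op1 op0 D t ⟩
    charPoly (apply op1 (adjD D)) t * charPoly (apply op0 (adjLine D)) t
  ≡⟨ cong₂ _*_ (charPoly-complete (adjD D) t) (charPoly-empty (adjLine D) t) ⟩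
    (t + + 1) ^ n * (t - + suc n + + 1) * t ^ m
  ≡⟨ rotate ((t + + 1) ^ n) (t - + suc n + + 1) (t ^ m) ⟩
    t ^ m * (t + + 1) ^ n * (t - + suc n + + 1)
  ∎
  where
  rotate : ∀ a b c → a * b * c ≡ c * a * b
  rotate = solve-∀

charPoly-1+0 : ∀ {n m} (D : Digraph (suc n) m) t →
  charPoly (total op1 op+ D) t ≡ (t + + 1) ^ n * (t - + suc n + + 1) * charPoly (adjLine D) t
charPoly-1+0 D t =
  trans (charPoly-total op1 op+ D t) (cong (_* charPoly (adjLine D) t) (charPoly-complete (adjD D) t))

-- (a3) with m ≥ n + 1 arcs: divide λ^(n+1) A(λ, D^l) = λ^m A(λ, D) by λ^(n+1)
charPoly-1+0-manyArcs : ∀ {n m} (D : Digraph (suc n) m) t → suc n ≤ m →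
  charPoly (total op1 op+ D) t ≡ t ^ (m ∸ suc n) * (t + + 1) ^ n * (t - + suc n + + 1) * charPoly (adjD D) t
charPoly-1+0-manyArcs {n} {m} D t n+1≤m = begin
    charPoly (total op1 op+ D) t
  ≡⟨ charPoly-1+0 D t ⟩
    K * charPoly (adjLine D) t
  ≡⟨ cong (K *_) (divide-powers (suc n) d (charMat-polyLike (adjMatrix (adjLine D)))
                                          (charMat-polyLike (adjMatrix (adjD D))) line t) ⟩
    K * (t ^ d * charPoly (adjD D) t)
  ≡⟨ regroup ((t + + 1) ^ n) (t - + suc n + + 1) (t ^ d) (charPoly (adjD D) t) ⟩
    t ^ d * (t + + 1) ^ n * (t - + suc n + + 1) * charPoly (adjD D) t
  ∎
  where
  d : ℕ
  d = m ∸ suc n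
  K : ℤ
  K = (t + + 1) ^ n * (t - + suc n + + 1)
  line : ∀ t → t ^ suc n * charPoly (adjLine D) t ≡ t ^ (suc n ℕ.+ d) * charPoly (adjD D) t
  line t = trans (charPoly-line D t) (cong (λ e → t ^ e * charPoly (adjD D) t) (sym (ℕP.m+[n∸m]≡n n+1≤m)))
  regroup : ∀ a b c y → a * b * (c * y) ≡ c * a * b * y
  regroup = solve-∀

-- (a3) with m < n + 1 arcs: divide λ^m A(λ, D) = λ^(n+1) A(λ, D^l) by λ^m
charPoly-1+0-fewArcs : ∀ {n m} (D : Digraph (suc n) m) t → m < suc n →
  t ^ (suc n ∸ m) * charPoly (total op1 op+ D) t ≡ (t + + 1) ^ n * (t - + suc n + + 1) * charPoly (adjD D) t
charPoly-1+0-fewArcs {n} {m} D t m<n+1 = begin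
    t ^ d * charPoly (total op1 op+ D) t
  ≡⟨ cong (t ^ d *_) (charPoly-1+0 D t) ⟩
    t ^ d * (K * charPoly (adjLine D) t)
  ≡⟨ exchange (t ^ d) K (charPoly (adjLine D) t) ⟩
    K * (t ^ d * charPoly (adjLine D) t)
  ≡⟨ cong (K *_) (sym (divide-powers m d (charMat-polyLike (adjMatrix (adjD D)))
                                         (charMat-polyLike (adjMatrix (adjLine D))) line t)) ⟩
    K * charPoly (adjD D) t
  ∎
  where
  d : ℕ
  d = suc n ∸ m
  K : ℤ
  K = (t + + 1) ^ n * (t - + suc n + + 1)
  line : ∀ t → t ^ m * charPoly (adjD D) t ≡ t ^ (m ℕ.+ d) * charPoly (adjLine D) t
  line t = trans (sym (charPoly-line D t))
                 (cong (λ e → t ^ e * charPoly (adjLine D) t) (sym (ℕP.m+[n∸m]≡n (ℕP.<⇒≤ m<n+1))))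
  exchange : ∀ c k y → c * (k * y) ≡ k * (c * y)
  exchange = solve-∀

theorem4p4 : (n : ℕ) → (m : ℕ) → (D : Digraph (suc n) m) →
  -- (a1) for x ∈ {0,1,+}; m ≥ 1 as written, m = 0 read as (λ+1)^(-1)(λ+1) = 1
  (((x : Op) → (x ≡ op0 ⊎ (x ≡ op1 ⊎ x ≡ op+)) → (λ' : ℤ) →
      ((k : ℕ) → m ≡ suc k →
        charPoly (total x op1 D) λ'
          ≡ ((λ' + + 1) ^ k) * (λ' - + m + + 1) * charPoly (apply x (adjD D)) λ')
    × (m ≡ 0 → charPoly (total x op1 D) λ' ≡ charPoly (apply x (adjD D)) λ'))
  -- (a2)
  × ((λ' : ℤ) →
      charPoly (total op1 op0 D) λ'
        ≡ (λ' ^ m) * ((λ' + + 1) ^ n) * (λ' - + (suc n) + + 1))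
  -- (a3): λ^(m-n) as a Laurent monomial
  × ((λ' : ℤ) →
      (suc n ≤ m →
        charPoly (total op1 op+ D) λ'
          ≡ (λ' ^ (m ∸ suc n)) * ((λ' + + 1) ^ n) * (λ' - + (suc n) + + 1)
              * charPoly (adjD D) λ')
    × (m < suc n →
        (λ' ^ (suc n ∸ m)) * charPoly (total op1 op+ D) λ'
          ≡ ((λ' + + 1) ^ n) * (λ' - + (suc n) + + 1) * charPoly (adjD D) λ')))
theorem4p4 n m D =
    (λ x _ t → charPoly-x10 x D t , charPoly-x10-noArcs x D t)
  , charPoly-100 D
  , (λ t → charPoly-1+0-manyArcs D t , charPoly-1+0-fewArcs D t)
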